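{- Let $p$ and $q$ be permutations. (a) If $M(p)$ and $M(q)$ are shape-equivalent for $1$-alternating AD-Young diagrams, then $|A_n(p)|=|A_n(q)|$ for all odd $n$. (b) If $M(p)$ and $M(q)$ are shape-equivalent for $1$-semialternating AD-Young diagrams, then $|A'_n(p)|=|A'_n(q)|$ for all even $n$. (c) If $M(p)$ and $M(q)$ are shape-equivalent for $2$-alternating AD-Young diagrams, then $|A_n(p)|=|A_n(q)|$ for all even $n$. (d) If $M(p)$ and $M(q)$ are shape-equivalent for $2$-semialternating AD-Young diagrams, then $|A'_n(p)|=|A'_n(q)|$ for all odd $n$.
   Context: For a permutation $p=p_1\cdots p_r$, $M(p)$ is its $r\times r$ permutation matrix, with a $1$ in position $(i,p_i)$ for each $i$. A permutation $w\in S_n$ is alternating if $w_1<w_2>w_3<\cdots$ and reverse alternating if $w_1>w_2<w_3>\cdots$; $A_n(q)$ (resp. $A'_n(q)$) is the set of alternating (resp. reverse alternating) permutations of length $n$ avoiding the pattern $q$ (no subsequence order-isomorphic to $q$). Young diagrams are in English notation with matrix coordinates: a Young diagram $Y=(Y_1\ge\cdots\ge Y_k)$ with $k$ rows consists of squares $(i,j)$, $1\le i\le k$, $1\le j\le Y_i$, and has $Y_1=k$. An AD-Young diagram is $(Y,A,D)$ with $A,D$ disjoint subsets of $[k-1]$ such that rows $i,i+1$ of $Y$ have equal length whenever $i\in A\cup D$. A transversal of $Y$ is a set $T=\{(i,t_i)\}$ of squares of $Y$ with exactly one in each row and column; it is valid for $(Y,A,D)$ if $t_i<t_{i+1}$ for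 all $i\in A$ and $t_i>t_{i+1}$ for all $i\in D$. For an $r\times r$ permutation matrix $M$, $T$ contains $M$ if there are rows $a_1<\cdots<a_r$ and columns $b_1<\cdots<b_r$ with $(a_r,b_r)\in Y$ such that $(a_i,b_j)\in T$ iff $M_{ij}=1$; otherwise $T$ avoids $M$. $S_{\mathcal{Y}}(M)$ is the set of valid transversals of $\mathcal{Y}$ avoiding $M$. $(Y,A,D)$ with $k$ rows is $x,y$-alternating if for all integers $i$ with $x-1\le i\le k-y$: $i\in A$ iff $i+1\in D$; $y$-alternating means $1,y$-alternating and $y$-semialternating means $2,y$-alternating. $M,N$ are shape-equivalent for $x$-alternating (resp. $x$-semialternating) AD-Young diagrams if $|S_{\mathcal{Y}}(M)|=|S_{\mathcal{Y}}(N)|$ for all such $\mathcal{Y}$. -}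

module Defs where

open import Data.Nat using (ℕ; zero; suc; _+_; _∸_; _≤_; _<_; _%_)
import Data.Nat.Properties as ℕP
open import Data.Fin using (Fin; toℕ) renaming (_<_ to _<ᶠ_; _≤_ to _≤ᶠ_)
open import Data.Fin.Properties using (any?; all?) renaming (_≟_ to _≟ᶠ_; _<?_ to _<ᶠ?_; _≤?_ to _≤ᶠ?_)
open import Data.Vec using (Vec; []; _∷_; lookup)
open import Data.List using (List; [_]; map; concatMap; filter; length; allFin)
open import Data.Bool using (Bool; true; false)
open import Data.Bool.Properties using () renaming (_≟_ to _≟ᵇ_)
open import Data.Product using (Σ; ∃; _×_; _,_)
open import Data.Sum using (_⊎_)
open import Data.Empty using (⊥)
open import Relation.Nullary using (Dec; yes; no; ¬_; does)
open import Relation.Nullary.Decidable using (map′; ¬?; _×-dec_; _→-dec_; _⊎-dec_)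
open import Relation.Binary.PropositionalEquality using (_≡_)

allVecs : {A : Set} → List A → (m : ℕ) → List (Vec A m)
allVecs xs zero    = [ [] ]
allVecs xs (suc m) = concatMap (λ x → map (x ∷_) (allVecs xs m)) xs

countVec : (n m : ℕ) {P : Vec (Fin n) m → Set} → ((v : Vec (Fin n) m) → Dec (P v)) → ℕ
countVec n m P? = length (filter P? (allVecs (allFin n) m))

anyVec? : ∀ {n} m {P : Vec (Fin n) m → Set} → ((v : Vec (Fin n) m) → Dec (P v)) → Dec (∃ P)
anyVec? zero P? with P? []
... | yes p = yes ([] , p)
... | no ¬p = no λ { ([] , p) → ¬p p }
anyVec? (suc m) {P} P? =
  map′ (λ { (x , v , p) → x ∷ v , p }) (λ { (x ∷ v , p) → x , v , p })
       (any? (λ x → anyVec? m {λ v → P (x ∷ v)} (λ v → P? (x ∷ v))))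

-- Permutations (0-based: a permutation of length n is the word
-- w = w₀ ⋯ w_{n-1} with entries in Fin n, w i = lookup w i)

Word : ℕ → Set
Word n = Vec (Fin n) n

IsPerm : ∀ {n} → Word n → Set
IsPerm w = ∀ i j → lookup w i ≡ lookup w j → i ≡ j

isPerm? : ∀ {n} (w : Word n) → Dec (IsPerm w)
isPerm? w = all? λ i → all? λ j → (lookup w i ≟ᶠ lookup w j) →-dec (i ≟ᶠ j)

-- alternating: w₁ < w₂ > w₃ < ⋯  (paper positions i+1 for 0-based i;
-- ascent at 0-based even positions, descent at odd ones)
Alternating : ∀ {n} → Word n → Set
Alternating w = ∀ i j → toℕ j ≡ suc (toℕ i) →
  (toℕ i % 2 ≡ 0 → lookup w i <ᶠ lookup w j) × (toℕ i % 2 ≡ 1 → lookup w j <ᶠ lookup w i)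

RevAlternating : ∀ {n} → Word n → Set
RevAlternating w = ∀ i j → toℕ j ≡ suc (toℕ i) →
  (toℕ i % 2 ≡ 0 → lookup w j <ᶠ lookup w i) × (toℕ i % 2 ≡ 1 → lookup w i <ᶠ lookup w j)

alternating? : ∀ {n} (w : Word n) → Dec (Alternating w)
alternating? w = all? λ i → all? λ j → (toℕ j ℕP.≟ suc (toℕ i)) →-dec
  (((toℕ i % 2 ℕP.≟ 0) →-dec (lookup w i <ᶠ? lookup w j)) ×-dec
   ((toℕ i % 2 ℕP.≟ 1) →-dec (lookup w j <ᶠ? lookup w i)))

revAlternating? : ∀ {n} (w : Word n) → Dec (RevAlternating w)
revAlternating? w = all? λ i → all? λ j → (toℕ j ℕP.≟ suc (toℕ i)) →-dec
  (((toℕ i % 2 ℕP.≟ 0) →-dec (lookup w j <ᶠ? lookup w i)) ×-dec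
   ((toℕ i % 2 ℕP.≟ 1) →-dec (lookup w i <ᶠ? lookup w j)))

Increasing : ∀ {n m} → Vec (Fin n) m → Set
Increasing c = ∀ i j → i <ᶠ j → lookup c i <ᶠ lookup c j

increasing? : ∀ {n m} (c : Vec (Fin n) m) → Dec (Increasing c)
increasing? c = all? λ i → all? λ j → (i <ᶠ? j) →-dec (lookup c i <ᶠ? lookup c j)

Contains : ∀ {r n} → Word r → Word n → Set
Contains {r} {n} p w = ∃ λ (c : Vec (Fin n) r) → Increasing c ×
  (∀ i j → (lookup w (lookup c i) <ᶠ lookup w (lookup c j) → lookup p i <ᶠ lookup p j)
         × (lookup p i <ᶠ lookup p j → lookup w (lookup c i) <ᶠ lookup w (lookup c j)))

contains? : ∀ {r n} (p : Word r) (w : Word n) → Dec (Contains p w)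
contains? {r} p w = anyVec? r λ c → increasing? c ×-dec
  (all? λ i → all? λ j →
     ((lookup w (lookup c i) <ᶠ? lookup w (lookup c j)) →-dec (lookup p i <ᶠ? lookup p j)) ×-dec
     ((lookup p i <ᶠ? lookup p j) →-dec (lookup w (lookup c i) <ᶠ? lookup w (lookup c j))))

Avoids : ∀ {r n} → Word r → Word n → Set
Avoids p w = ¬ Contains p w

numA : (n : ℕ) → ∀ {r} → Word r → ℕ
numA n p = countVec n n (λ w → isPerm? w ×-dec (alternating? w ×-dec ¬? (contains? p w)))

numA' : (n : ℕ) → ∀ {r} → Word r → ℕ
numA' n p = countVec n n (λ w → isPerm? w ×-dec (revAlternating? w ×-dec ¬? (contains? p w)))

Mat : ℕ → Set
Mat r = Fin r → Fin r → ℕ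

M : ∀ {r} → Word r → Mat r
M p i j with does (lookup p i ≟ᶠ j)
... | true  = 1
... | false = 0

-- Rows and columns are 0-based elements of Fin k (paper row/column a+1);
-- square (a , c) lies in Y iff toℕ c < Y a.  The sets A, D ⊆ [k-1] are
-- given as Boolean predicates on ℕ with the paper's 1-based indexing:
-- paper index i ∈ A means rows i, i+1 (0-based rows i-1, i).

record ADYoung : Set where
  field
    k      : ℕ
    Y      : Fin k → ℕ
    A D    : ℕ → Bool
    pos    : ∀ a → 1 ≤ Y a
    decr   : ∀ a b → a ≤ᶠ b → Y b ≤ Y a
    first  : ∀ a → toℕ a ≡ 0 → Y a ≡ k
    A⊆     : ∀ i → A i ≡ true → 1 ≤ i × i < k
    D⊆     : ∀ i → D i ≡ true → 1 ≤ i × i < k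
    disj   : ∀ i → A i ≡ true → D i ≡ true → ⊥
    eqlen  : ∀ a b → toℕ b ≡ suc (toℕ a) →
             A (suc (toℕ a)) ≡ true ⊎ D (suc (toℕ a)) ≡ true → Y a ≡ Y b

module _ (𝒴 : ADYoung) where
  open ADYoung 𝒴

  InY : Fin k → Fin k → Set
  InY a c = toℕ c < Y a

  -- a transversal: t a is the column of the square in row a
  Transversal : Vec (Fin k) k → Set
  Transversal t = (∀ a → InY a (lookup t a)) × (∀ a b → lookup t a ≡ lookup t b → a ≡ b)

  Valid : Vec (Fin k) k → Set
  Valid t = ∀ a b → toℕ b ≡ suc (toℕ a) →
    (A (suc (toℕ a)) ≡ true → lookup t a <ᶠ lookup t b) ×
    (D (suc (toℕ a)) ≡ true → lookup t b <ᶠ lookup t a)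

  ContainsMat : ∀ {r} → Mat r → Vec (Fin k) k → Set
  ContainsMat {r} Mx t = ∃ λ (as : Vec (Fin k) r) → ∃ λ (bs : Vec (Fin k) r) →
    Increasing as × Increasing bs ×
    (∀ i → suc (toℕ i) ≡ r → InY (lookup as i) (lookup bs i)) ×
    (∀ i j → (lookup t (lookup as i) ≡ lookup bs j → Mx i j ≡ 1) ×
             (Mx i j ≡ 1 → lookup t (lookup as i) ≡ lookup bs j))

  transversal? : (t : Vec (Fin k) k) → Dec (Transversal t)
  transversal? t = (all? λ a → toℕ (lookup t a) ℕP.<? Y a) ×-dec
                   (all? λ a → all? λ b → (lookup t a ≟ᶠ lookup t b) →-dec (a ≟ᶠ b))

  valid? : (t : Vec (Fin k) k) → Dec (Valid t)
  valid? t = all? λ a → all? λ b → (toℕ b ℕP.≟ suc (toℕ a)) →-dec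
    (((A (suc (toℕ a)) ≟ᵇ true) →-dec (lookup t a <ᶠ? lookup t b)) ×-dec
     ((D (suc (toℕ a)) ≟ᵇ true) →-dec (lookup t b <ᶠ? lookup t a)))

  containsMat? : ∀ {r} (Mx : Mat r) (t : Vec (Fin k) k) → Dec (ContainsMat Mx t)
  containsMat? {r} Mx t = anyVec? r λ as → anyVec? r λ bs →
    increasing? as ×-dec (increasing? bs ×-dec
    ((all? λ i → (suc (toℕ i) ℕP.≟ r) →-dec (toℕ (lookup bs i) ℕP.<? Y (lookup as i))) ×-dec
     (all? λ i → all? λ j →
       ((lookup t (lookup as i) ≟ᶠ lookup bs j) →-dec (Mx i j ℕP.≟ 1)) ×-dec
       ((Mx i j ℕP.≟ 1) →-dec (lookup t (lookup as i) ≟ᶠ lookup bs j)))))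

  numS : ∀ {r} → Mat r → ℕ
  numS Mx = countVec k k (λ t → transversal? t ×-dec (valid? t ×-dec ¬? (containsMat? Mx t)))

-- (Y,A,D) is x,y-alternating: for all integers i with x-1 ≤ i ≤ k-y,
-- i ∈ A iff i+1 ∈ D   (for x ≥ 1 such i are natural numbers)
XYAlternating : ℕ → ℕ → ADYoung → Set
XYAlternating x y 𝒴 = ∀ i → x ∸ 1 ≤ i → i + y ≤ ADYoung.k 𝒴 →
  (ADYoung.A 𝒴 i ≡ true → ADYoung.D 𝒴 (suc i) ≡ true) ×
  (ADYoung.D 𝒴 (suc i) ≡ true → ADYoung.A 𝒴 i ≡ true)

YAlternating : ℕ → ADYoung → Set
YAlternating y = XYAlternating 1 y

YSemialternating : ℕ → ADYoung → Set
YSemialternating y = XYAlternating 2 y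

ShapeEquivalent : (ADYoung → Set) → ∀ {r s} → Mat r → Mat s → Set
ShapeEquivalent C Mx Nx = ∀ 𝒴 → C 𝒴 → numS 𝒴 Mx ≡ numS 𝒴 Nx

Odd Even : ℕ → Set
Odd n = n % 2 ≡ 1
Even n = n % 2 ≡ 0

module Submission where

-- Take the n×n square diagram (all rows of length n) and put the
-- paper index i (the pair of rows i, i+1) into A or D according to an up-down
-- signature σ : ℕ → Bool, namely i = a+1 ∈ A if σ a and i ∈ D otherwise
-- (for 1 ≤ i < n).
-- Its transversals are exactly the permutations of length n, its valid
-- transversals are those whose ascents and descents follow σ, and (the square
-- imposing no shape restriction) such a transversal contains M(p) iff the
-- permutation contains p.  Hence |S(M p)| of the square with σ = even counts
-- alternating and with σ = odd reverse alternating permutations avoiding p.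
-- It remains to see which square diagrams lie in the four classes: whenever σ
-- alternates, "i ∈ A iff i+1 ∈ D" can only fail at the boundary indices i = 0
-- (excluded exactly for semialternating diagrams) and i = n-1 (excluded exactly
-- for y = 2), which gives the four parity conditions of the theorem.

open import Defs
open import Data.Nat using (ℕ; zero; suc; _+_; _∸_; _≤_; _<_; _%_; _<ᵇ_; z≤n; s≤s)
import Data.Nat.Properties as ℕP
open import Data.Fin using (Fin; toℕ; punchOut) renaming (_<_ to _<ᶠ_)
import Data.Fin.Properties as FinP
open import Data.Vec using (Vec; lookup; tabulate)
open import Data.Vec.Properties using (lookup∘tabulate)
open import Data.List using (length; filter; allFin)
open import Data.List.Properties using (filter-≐)
open import Data.Bool using (Bool; true; false; not; _∧_)
open import Data.Bool.Properties using (T-≡; not-involutive; not-¬; ∧-conicalˡ; ∧-conicalʳ; ∧-zeroʳ)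
open import Data.Product using (∃; _×_; _,_; proj₁; proj₂)
open import Data.Sum using (inj₁; inj₂; _⊎_)
open import Data.Empty using (⊥)
open import Function.Bundles using (_⇔_; mk⇔; Equivalence)
import Function.Properties.Equivalence as ⇔
open import Relation.Nullary using (Dec; yes; no; ¬_; contradiction)
open import Relation.Nullary.Decidable using (_×-dec_; ¬?)
open import Relation.Unary using (_≐_)
open import Relation.Binary using (tri<; tri≈; tri>)
open import Relation.Binary.PropositionalEquality
  using (_≡_; refl; sym; trans; cong; subst; subst₂; module ≡-Reasoning)

open Equivalence using (to; from)

countVec-cong : ∀ {n m} {P Q : Vec (Fin n) m → Set}
  (P? : ∀ v → Dec (P v)) (Q? : ∀ v → Dec (Q v)) → P ≐ Q → countVec n m P? ≡ countVec n m Q?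
countVec-cong {n} {m} P? Q? P≐Q = cong length (filter-≐ P? Q? P≐Q (allVecs (allFin n) m))

-- Pigeonhole: an injective endomap of Fin n is surjective.  If j were missed,
-- punching j out would give an injection Fin n → Fin (n-1).
injective⇒surjective : ∀ {n} (f : Fin n → Fin n) →
  (∀ i j → f i ≡ f j → i ≡ j) → ∀ j → ∃ λ i → f i ≡ j
injective⇒surjective {suc m} f f-inj j with FinP.any? (λ i → f i FinP.≟ j)
... | yes hit = hit
... | no ¬hit = contradiction (FinP.injective⇒≤ g-inj) ℕP.1+n≰n
  where
  misses : ∀ i → j ≡ f i → ⊥
  misses i j≡fi = ¬hit (i , sym j≡fi)
  g : Fin (suc m) → Fin m
  g i = punchOut (misses i)
  g-inj : ∀ {x y} → g x ≡ g y → x ≡ y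
  g-inj {x} {y} gx≡gy = f-inj x y (FinP.punchOut-injective (misses x) (misses y) gx≡gy)

module Inverse {r} (p : Word r) (p-perm : IsPerm p) where
  p⁻¹ : Fin r → Fin r
  p⁻¹ j = proj₁ (injective⇒surjective (lookup p) p-perm j)

  p∘p⁻¹ : ∀ j → lookup p (p⁻¹ j) ≡ j
  p∘p⁻¹ j = proj₂ (injective⇒surjective (lookup p) p-perm j)

  p⁻¹∘p : ∀ i → p⁻¹ (lookup p i) ≡ i
  p⁻¹∘p i = p-perm _ _ (p∘p⁻¹ (lookup p i))

increasing-injective : ∀ {n m} (c : Vec (Fin n) m) → Increasing c →
  ∀ i j → lookup c i ≡ lookup c j → i ≡ j
increasing-injective c c-inc i j ci≡cj with FinP.<-cmp i j
... | tri< i<j _ _ = contradiction ci≡cj (FinP.<⇒≢ (c-inc i j i<j))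
... | tri≈ _ i≡j _ = i≡j
... | tri> _ _ j<i = contradiction (sym ci≡cj) (FinP.<⇒≢ (c-inc j i j<i))

increasing-reflects : ∀ {n m} (c : Vec (Fin n) m) → Increasing c →
  ∀ i j → lookup c i <ᶠ lookup c j → i <ᶠ j
increasing-reflects c c-inc i j ci<cj with FinP.<-cmp i j
... | tri< i<j _ _ = i<j
... | tri≈ _ refl _ = contradiction ci<cj (FinP.<-irrefl refl)
... | tri> _ _ j<i = contradiction (FinP.<-trans ci<cj (c-inc j i j<i)) (FinP.<-irrefl refl)

M≡1⇔ : ∀ {r} (p : Word r) i j → M p i j ≡ 1 ⇔ lookup p i ≡ j
M≡1⇔ p i j with lookup p i FinP.≟ j
... | yes pi≡j = mk⇔ (λ _ → pi≡j) (λ _ → refl)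
... | no pi≢j  = mk⇔ (λ ()) (λ pi≡j → contradiction pi≡j pi≢j)

-- In any AD-Young diagram, a transversal containing M(p) contains p as a
-- pattern when read as a word: the chosen rows carry the columns bs (p i), and
-- the increasing vector bs both preserves and reflects the order.
containsMat⇒contains : ∀ 𝒴 {r} (p : Word r) t → ContainsMat 𝒴 (M p) t → Contains p t
containsMat⇒contains 𝒴 p t (as , bs , as-inc , bs-inc , _ , hits) =
  as , as-inc , λ i j → reflect i j , preserve i j
  where
  column : ∀ i → lookup t (lookup as i) ≡ lookup bs (lookup p i)
  column i = proj₂ (hits i (lookup p i)) (from (M≡1⇔ p i _) refl)

  reflect : ∀ i j → lookup t (lookup as i) <ᶠ lookup t (lookup as j) → lookup p i <ᶠ lookup p j
  reflect i j lt = increasing-reflects bs bs-inc _ _ (subst₂ _<ᶠ_ (column i) (column j) lt)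

  preserve : ∀ i j → lookup p i <ᶠ lookup p j → lookup t (lookup as i) <ᶠ lookup t (lookup as j)
  preserve i j lt = subst₂ _<ᶠ_ (sym (column i)) (sym (column j)) (bs-inc _ _ lt)

-- Boolean parity; odd (suc a) and not (odd a) agree definitionally, so both
-- even and odd are alternating signatures.
even : ℕ → Bool
even zero    = true
even (suc a) = not (even a)

odd : ℕ → Bool
odd a = not (even a)

not≡true⇔ : ∀ b → not b ≡ true ⇔ b ≡ false
not≡true⇔ true  = mk⇔ (λ ()) (λ ())
not≡true⇔ false = mk⇔ (λ _ → refl) (λ _ → refl)

parity : ∀ a → (even a ≡ true × a % 2 ≡ 0) ⊎ (even a ≡ false × a % 2 ≡ 1)
parity zero          = inj₁ (refl , refl)
parity (suc zero)    = inj₂ (refl , refl)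
parity (suc (suc a)) rewrite not-involutive (even a) = parity a

even≡true⇔ : ∀ a → even a ≡ true ⇔ a % 2 ≡ 0
even≡true⇔ a with parity a
... | inj₁ (e , r) rewrite e | r = mk⇔ (λ _ → refl) (λ _ → refl)
... | inj₂ (e , r) rewrite e | r = mk⇔ (λ ()) (λ ())

even≡false⇔ : ∀ a → even a ≡ false ⇔ a % 2 ≡ 1
even≡false⇔ a with parity a
... | inj₁ (e , r) rewrite e | r = mk⇔ (λ ()) (λ ())
... | inj₂ (e , r) rewrite e | r = mk⇔ (λ _ → refl) (λ _ → refl)

odd≡false⇔ : ∀ a → odd a ≡ false ⇔ a % 2 ≡ 0
odd≡false⇔ a with parity a
... | inj₁ (e , r) rewrite e | r = mk⇔ (λ _ → refl) (λ _ → refl)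
... | inj₂ (e , r) rewrite e | r = mk⇔ (λ ()) (λ ())

odd≡true⇔ : ∀ a → odd a ≡ true ⇔ a % 2 ≡ 1
odd≡true⇔ a = ⇔.trans (not≡true⇔ (even a)) (even≡false⇔ a)

<ᵇ≡true⇔ : ∀ m n → (m <ᵇ n) ≡ true ⇔ m < n
<ᵇ≡true⇔ m n = ⇔.trans (⇔.sym T-≡) (mk⇔ (ℕP.<ᵇ⇒< m n) ℕP.<⇒<ᵇ)

UpDown : ∀ {n} → (ℕ → Bool) → Word n → Set
UpDown σ w = ∀ a b → toℕ b ≡ suc (toℕ a) →
  (σ (toℕ a) ≡ true → lookup w a <ᶠ lookup w b) × (σ (toℕ a) ≡ false → lookup w b <ᶠ lookup w a)

alternating⇔upDown : ∀ {n} (w : Word n) → Alternating w ⇔ UpDown even w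
alternating⇔upDown w = mk⇔
  (λ alt a b b≡a+1 → (λ e → proj₁ (alt a b b≡a+1) (to (even≡true⇔ (toℕ a)) e))
                   , (λ e → proj₂ (alt a b b≡a+1) (to (even≡false⇔ (toℕ a)) e)))
  (λ ud a b b≡a+1 → (λ r → proj₁ (ud a b b≡a+1) (from (even≡true⇔ (toℕ a)) r))
                  , (λ r → proj₂ (ud a b b≡a+1) (from (even≡false⇔ (toℕ a)) r)))

revAlternating⇔upDown : ∀ {n} (w : Word n) → RevAlternating w ⇔ UpDown odd w
revAlternating⇔upDown w = mk⇔
  (λ rev a b b≡a+1 → (λ o → proj₂ (rev a b b≡a+1) (to (odd≡true⇔ (toℕ a)) o))
                   , (λ o → proj₁ (rev a b b≡a+1) (to (odd≡false⇔ (toℕ a)) o)))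
  (λ ud a b b≡a+1 → (λ r → proj₂ (ud a b b≡a+1) (from (odd≡false⇔ (toℕ a)) r))
                  , (λ r → proj₁ (ud a b b≡a+1) (from (odd≡true⇔ (toℕ a)) r)))

module Square (n : ℕ) (σ : ℕ → Bool) where
  ascents descents : ℕ → Bool
  ascents zero     = false
  ascents (suc a)  = (suc a <ᵇ n) ∧ σ a
  descents zero    = false
  descents (suc a) = (suc a <ᵇ n) ∧ not (σ a)

  inRange : ∀ i {b} → ((i <ᵇ n) ∧ b) ≡ true → i < n
  inRange i e = to (<ᵇ≡true⇔ i n) (∧-conicalˡ _ _ e)

  ascents⊆ : ∀ i → ascents i ≡ true → 1 ≤ i × i < n
  ascents⊆ (suc a) e = s≤s z≤n , inRange (suc a) e

  descents⊆ : ∀ i → descents i ≡ true → 1 ≤ i × i < n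
  descents⊆ (suc a) e = s≤s z≤n , inRange (suc a) e

  disjoint : ∀ i → ascents i ≡ true → descents i ≡ true → ⊥
  disjoint (suc a) asc desc =
    not-¬ {σ a} refl (trans (∧-conicalʳ _ _ asc) (sym (∧-conicalʳ _ _ desc)))

  square : ADYoung
  square = record
    { k = n ; Y = λ _ → n ; A = ascents ; D = descents
    ; pos = λ a → ℕP.≤-trans (s≤s z≤n) (FinP.toℕ<n a)
    ; decr = λ _ _ _ → ℕP.≤-refl
    ; first = λ _ _ → refl
    ; A⊆ = ascents⊆ ; D⊆ = descents⊆ ; disj = disjoint
    ; eqlen = λ _ _ _ _ → refl
    }

  adjacent-inner : ∀ (a b : Fin n) → toℕ b ≡ suc (toℕ a) → (suc (toℕ a) <ᵇ n) ≡ true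
  adjacent-inner a b b≡a+1 = from (<ᵇ≡true⇔ _ n) (subst (_< n) b≡a+1 (FinP.toℕ<n b))

  -- Every column of the square is available in every row, so its transversals
  -- are the permutations.
  transversal⇔perm : ∀ t → Transversal square t ⇔ IsPerm t
  transversal⇔perm t = mk⇔ proj₂ (λ t-perm → (λ a → FinP.toℕ<n (lookup t a)) , t-perm)

  valid⇔upDown : ∀ t → Valid square t ⇔ UpDown σ t
  valid⇔upDown t = mk⇔ toUpDown toValid
    where
    toUpDown : Valid square t → UpDown σ t
    toUpDown v a b b≡a+1 with suc (toℕ a) <ᵇ n | adjacent-inner a b b≡a+1 | v a b b≡a+1
    ... | true | refl | asc , desc = asc , λ σa≡false → desc (from (not≡true⇔ _) σa≡false)

    toValid : UpDown σ t → Valid square t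
    toValid ud a b b≡a+1 with suc (toℕ a) <ᵇ n | adjacent-inner a b b≡a+1
    ... | true | refl = proj₁ (ud a b b≡a+1)
                      , λ notσa≡true → proj₂ (ud a b b≡a+1) (to (not≡true⇔ _) notσa≡true)

  -- Converse of containsMat⇒contains for the square: if the permutation t
  -- contains the permutation p at positions c, the columns bs j = t (c (p⁻¹ j))
  -- exhibit M(p) in the square; that the last chosen cell lies in Y is automatic.
  contains⇒containsMat : ∀ {r} (p : Word r) → IsPerm p → ∀ t → IsPerm t →
    Contains p t → ContainsMat square (M p) t
  contains⇒containsMat {r} p p-perm t t-perm (c , c-inc , order) =
    c , bs , c-inc , bs-inc , (λ i _ → FinP.toℕ<n (lookup bs i)) , λ i j → hit⇒one i j , one⇒hit i j
    where
    open Inverse p p-perm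
    column : Fin r → Fin n
    column j = lookup t (lookup c (p⁻¹ j))
    bs : Vec (Fin n) r
    bs = tabulate column

    bs-inc : Increasing bs
    bs-inc j j′ j<j′ rewrite lookup∘tabulate column j | lookup∘tabulate column j′ =
      proj₂ (order (p⁻¹ j) (p⁻¹ j′)) (subst₂ _<ᶠ_ (sym (p∘p⁻¹ j)) (sym (p∘p⁻¹ j′)) j<j′)

    hit⇒one : ∀ i j → lookup t (lookup c i) ≡ lookup bs j → M p i j ≡ 1
    hit⇒one i j hit rewrite lookup∘tabulate column j =
      from (M≡1⇔ p i j)
        (trans (cong (lookup p) (increasing-injective c c-inc _ _ (t-perm _ _ hit))) (p∘p⁻¹ j))

    one⇒hit : ∀ i j → M p i j ≡ 1 → lookup t (lookup c i) ≡ lookup bs j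
    one⇒hit i j one rewrite lookup∘tabulate column j | sym (to (M≡1⇔ p i j) one) | p⁻¹∘p i = refl

  numS-square : ∀ {r} (p : Word r) → IsPerm p →
    {Sig : Word n → Set} (sig? : ∀ w → Dec (Sig w)) → (∀ w → Sig w ⇔ UpDown σ w) →
    numS square (M p) ≡ countVec n n (λ w → isPerm? w ×-dec (sig? w ×-dec ¬? (contains? p w)))
  numS-square p p-perm {Sig} sig? sig⇔ = countVec-cong
    (λ t → transversal? square t ×-dec (valid? square t ×-dec ¬? (containsMat? square (M p) t)))
    (λ w → isPerm? w ×-dec (sig? w ×-dec ¬? (contains? p w)))
    (fromDiagram , toDiagram)
    where
    fromDiagram : ∀ {t} → Transversal square t × Valid square t × ¬ ContainsMat square (M p) t →
      IsPerm t × Sig t × ¬ Contains p t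
    fromDiagram {t} (transversal , valid , avoids) =
      t-perm , from (sig⇔ t) (to (valid⇔upDown t) valid) ,
      λ contains → avoids (contains⇒containsMat p p-perm t t-perm contains)
      where t-perm = to (transversal⇔perm t) transversal

    toDiagram : ∀ {t} → IsPerm t × Sig t × ¬ Contains p t →
      Transversal square t × Valid square t × ¬ ContainsMat square (M p) t
    toDiagram {t} (t-perm , sig , avoids) =
      from (transversal⇔perm t) t-perm , from (valid⇔upDown t) (to (sig⇔ t) sig) ,
      λ containsMat → avoids (containsMat⇒contains square p t containsMat)

  -- If σ alternates then "i ∈ A iff i+1 ∈ D" holds for all inner i; it can only
  -- fail at the boundary index i = 0, which needs σ 0, and at i = n-1, which
  -- needs ¬ σ (n-2).  Each boundary only matters when it lies in the range.
  square-xyAlternating : ∀ x y → (∀ a → σ (suc a) ≡ not (σ a)) →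
    (x ∸ 1 ≡ 0 → σ 0 ≡ true) → (∀ a → y ≤ 1 → suc (suc a) ≡ n → σ a ≡ false) →
    XYAlternating x y square
  square-xyAlternating x y alternates lower upper i x∸1≤i i+y≤n =
    (λ e → trans (sym (ascents≡descents i x∸1≤i i+y≤n)) e) ,
    (λ e → trans (ascents≡descents i x∸1≤i i+y≤n) e)
    where
    notInner : ∀ {m} → (m <ᵇ n) ≡ false → ¬ m < n
    notInner m≮ᵇn m<n with () ← trans (sym m≮ᵇn) (from (<ᵇ≡true⇔ _ n) m<n)

    ascents≡descents : ∀ i → x ∸ 1 ≤ i → i + y ≤ n → ascents i ≡ descents (suc i)
    ascents≡descents zero x∸1≤0 _ rewrite lower (ℕP.n≤0⇒n≡0 x∸1≤0) = sym (∧-zeroʳ _)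
    ascents≡descents (suc a) _ i+y≤n rewrite alternates a | not-involutive (σ a)
      with suc a <ᵇ n in inner₁ | suc (suc a) <ᵇ n in inner₂
    ... | true  | true  = refl
    ... | false | false = refl
    ... | false | true  = contradiction (ℕP.<⇒≤ (to (<ᵇ≡true⇔ _ n) inner₂)) (notInner inner₁)
    ... | true  | false = upper a y≤1 a+2≡n
      where
      a+2≡n : suc (suc a) ≡ n
      a+2≡n = ℕP.≤-antisym (to (<ᵇ≡true⇔ _ n) inner₁) (ℕP.≮⇒≥ (notInner inner₂))
      y≤1 : y ≤ 1
      y≤1 = ℕP.+-cancelˡ-≤ (suc a) y 1
              (subst (suc a + y ≤_) (trans (sym a+2≡n) (ℕP.+-comm 1 (suc a))) i+y≤n)

open Square using (square; numS-square; square-xyAlternating)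

numS-alternating : ∀ n {r} (p : Word r) → IsPerm p → numS (square n even) (M p) ≡ numA n p
numS-alternating n p p-perm = numS-square n even p p-perm alternating? alternating⇔upDown

numS-revAlternating : ∀ n {r} (p : Word r) → IsPerm p → numS (square n odd) (M p) ≡ numA' n p
numS-revAlternating n p p-perm = numS-square n odd p p-perm revAlternating? revAlternating⇔upDown

-- Membership of these squares in the four classes of the theorem: the index
-- i = 0 needs even 0 (so only x = 1 works for σ = even, while x = 2 excludes
-- it for σ = odd), and the index i = n-1 needs σ (n-2) false (a parity
-- condition on n for y = 1, vacuous for y = 2).
alternating-1 : ∀ n → Odd n → YAlternating 1 (square n even)
alternating-1 n n-odd = square-xyAlternating n even 1 1 (λ _ → refl) (λ _ → refl)
  (λ a _ a+2≡n → from (even≡false⇔ a) (subst Odd (sym a+2≡n) n-odd))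

revAlternating-1 : ∀ n → Even n → YSemialternating 1 (square n odd)
revAlternating-1 n n-even = square-xyAlternating n odd 2 1 (λ _ → refl) (λ ())
  (λ a _ a+2≡n → from (odd≡false⇔ a) (subst Even (sym a+2≡n) n-even))

alternating-2 : ∀ n → YAlternating 2 (square n even)
alternating-2 n = square-xyAlternating n even 1 2 (λ _ → refl) (λ _ → refl) (λ { _ (s≤s ()) _ })

revAlternating-2 : ∀ n → YSemialternating 2 (square n odd)
revAlternating-2 n = square-xyAlternating n odd 2 2 (λ _ → refl) (λ ()) (λ { _ (s≤s ()) _ })

proposition3p7 : ∀ {r s} (p : Word r) (q : Word s) → IsPerm p → IsPerm q →
      (ShapeEquivalent (YAlternating 1) (M p) (M q) → ∀ n → Odd n → numA n p ≡ numA n q)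
    × (ShapeEquivalent (YSemialternating 1) (M p) (M q) → ∀ n → Even n → numA' n p ≡ numA' n q)
    × (ShapeEquivalent (YAlternating 2) (M p) (M q) → ∀ n → Even n → numA n p ≡ numA n q)
    × (ShapeEquivalent (YSemialternating 2) (M p) (M q) → ∀ n → Odd n → numA' n p ≡ numA' n q)
proposition3p7 p q p-perm q-perm =
    (λ equiv n n-odd → transfer (square n even) equiv (alternating-1 n n-odd) (numS-alternating n))
  , (λ equiv n n-even → transfer (square n odd) equiv (revAlternating-1 n n-even) (numS-revAlternating n))
  , (λ equiv n _ → transfer (square n even) equiv (alternating-2 n) (numS-alternating n))
  , (λ equiv n _ → transfer (square n odd) equiv (revAlternating-2 n) (numS-revAlternating n))
  where
  transfer : ∀ {C} 𝒴 {count : ∀ {r} → Word r → ℕ} → ShapeEquivalent C (M p) (M q) → C 𝒴 →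
    (∀ {r} (w : Word r) → IsPerm w → numS 𝒴 (M w) ≡ count w) → count p ≡ count q
  transfer 𝒴 {count} equiv 𝒴∈C realises = begin
    count p        ≡⟨ sym (realises p p-perm) ⟩
    numS 𝒴 (M p)  ≡⟨ equiv 𝒴 𝒴∈C ⟩
    numS 𝒴 (M q)  ≡⟨ realises q q-perm ⟩
    count q        ∎
    where open ≡-Reasoning
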